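{- Let $G$ be a connected, symmetric, deterministic and co-deterministic graph and let $r\in V_G$. Then for all $s,t\in V_G$ there is a unique $x$ with $(s,t,x)\in\mathrm{Chain}_G(r)$, so that the chain-operation $\overline{\ast}_r$ (with $s\,\overline{\ast}_r\,t$ this unique $x$) is defined, and $(V_G,\overline{\ast}_r)$ is a group with identity $r$ generated (as a group) by $\to_G(r)=\{s: r\to_G s\}$. If moreover $G$ is simple, then $G=\mathcal{C}\langle V_G,\to_G(r)\rangle$ for the operation $\overline{\ast}_r$, where $\langle s\rangle=a$ whenever $r\xrightarrow{a}_G s$.
   Context: A graph is a non-empty set $G\subseteq V\times A\times V$ of labeled edges $s\xrightarrow{a}_G t$; $s\to_G t$ means such an edge exists for some $a$; $V_G$ is the set of vertices occurring in edges, $A_G$ the set of labels. $G$ is connected if any two vertices are joined by a path ignoring edge directions; deterministic if $r\xrightarrow{a}s$, $r\xrightarrow{a}t$ imply $s=t$; co-deterministic if $s\xrightarrow{a}r$, $t\xrightarrow{a}r$ imply $s=t$; simple if no two edges share source and target; symmetric if for all $s,t\in V_G$ some automorphism of $G$ maps $s$ to $t$. Let $\overline{A_G}=\{\overline{a}: a\in A_G\}$ be a disjoint copy of $A_G$ and set $s\xrightarrow{\overline{a}}_G t$ whenever $t\xrightarrow{a}_G s$; a chain $s\xrightarrow{u}_G t$ is a path labeled by $u\in(A_G\cup\overline{A_G})^*$ using these extended steps. The chain-relation $\mathrm{Chain}_G(r)$ is the set of triples $(s,t,x)$ such that for some $u\in(A_G\cup\overline{A_G})^*$, $r\xrightarrow{u}_G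 t$ and $s\xrightarrow{u}_G x$. For a magma $(M,\cdot)$, $Q\subseteq M$ and injective $\langle\,\rangle:Q\to A$, $\mathcal{C}\langle M,Q\rangle=\{(p,\langle q\rangle,p\cdot q): p\in M,\ q\in Q\}$. -}

module Defs where

open import Data.Product using (Σ; ∃; ∃-syntax; _×_; _,_; proj₁; proj₂)
open import Data.Sum using (_⊎_; inj₁; inj₂)
open import Data.List using (List; []; _∷_)
open import Relation.Binary.PropositionalEquality using (_≡_)

data Gen {C : Set} (_≈_ : C → C → Set) (_∙_ : C → C → C) (ε : C)
         (_⁻¹ : C → C) (S : C → Set) : C → Set where
  gen-base : ∀ {x} → S x → Gen _≈_ _∙_ ε _⁻¹ S x
  gen-unit : Gen _≈_ _∙_ ε _⁻¹ S ε
  gen-mul  : ∀ {x y} → Gen _≈_ _∙_ ε _⁻¹ S x → Gen _≈_ _∙_ ε _⁻¹ S y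
           → Gen _≈_ _∙_ ε _⁻¹ S (x ∙ y)
  gen-inv  : ∀ {x} → Gen _≈_ _∙_ ε _⁻¹ S x → Gen _≈_ _∙_ ε _⁻¹ S (x ⁻¹)
  gen-resp : ∀ {x y} → x ≈ y → Gen _≈_ _∙_ ε _⁻¹ S x → Gen _≈_ _∙_ ε _⁻¹ S y

GeneratedBy : {C : Set} (_≈_ : C → C → Set) (_∙_ : C → C → C) (ε : C)
              (_⁻¹ : C → C) (S : C → Set) → Set
GeneratedBy {C} _≈_ _∙_ ε _⁻¹ S = ∀ (x : C) → Gen _≈_ _∙_ ε _⁻¹ S x

-- A graph G ⊆ V × A × V is given as a predicate G s a t  (s --a--> t).
module _ {V A : Set} (G : V → A → V → Set) where

  NonEmpty : Set
  NonEmpty = ∃[ s ] ∃[ a ] ∃[ t ] G s a t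

  InV : V → Set
  InV v = (∃[ a ] ∃[ t ] G v a t) ⊎ (∃[ s ] ∃[ a ] G s a v)

  VG : Set
  VG = Σ V InV

  _≈V_ : VG → VG → Set
  x ≈V y = proj₁ x ≡ proj₁ y

  _⟶_ : V → V → Set
  s ⟶ t = ∃[ a ] G s a t

  -- extended steps: inj₁ a is a, inj₂ a is the barred copy ā
  Step : V → A ⊎ A → V → Set
  Step s (inj₁ a) t = G s a t
  Step s (inj₂ a) t = G t a s

  data Chain : V → List (A ⊎ A) → V → Set where
    chain-nil  : ∀ {s} → Chain s [] s
    chain-cons : ∀ {s t x b u} → Step s b t → Chain t u x → Chain s (b ∷ u) x

  ChainRel : V → V → V → V → Set
  ChainRel r s t x = ∃[ u ] (Chain r u t × Chain s u x)

  Connected : Set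
  Connected = ∀ (x y : VG) → ∃[ u ] Chain (proj₁ x) u (proj₁ y)

  Deterministic : Set
  Deterministic = ∀ {r s t a} → G r a s → G r a t → s ≡ t

  CoDeterministic : Set
  CoDeterministic = ∀ {r s t a} → G s a r → G t a r → s ≡ t

  Simple : Set
  Simple = ∀ {s t a b} → G s a t → G s b t → a ≡ b

  IsAutomorphism : (VG → VG) → Set
  IsAutomorphism f =
    (∀ {x y} → x ≈V y → f x ≈V f y) ×
    (∀ {x y} → f x ≈V f y → x ≈V y) ×
    (∀ y → ∃[ x ] f x ≈V y) ×
    (∀ x a y → (G (proj₁ x) a (proj₁ y) → G (proj₁ (f x)) a (proj₁ (f y))) ×
               (G (proj₁ (f x)) a (proj₁ (f y)) → G (proj₁ x) a (proj₁ y)))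

  Symmetric : Set
  Symmetric = ∀ (s t : VG) → ∃[ f ] (IsAutomorphism f × f s ≈V t)

  -- the "Cayley" edge set C⟨V_G, →_G(r)⟩ for an operation _∙_ on V_G,
  -- with label ⟨q⟩ = a where r --a--> q (the label of the witnessing edge):
  -- p --⟨q⟩--> p ∙ q  for  q ∈ →_G(r)
  CayleyEdge : (r : V) (_∙_ : VG → VG → VG) → V → A → V → Set
  CayleyEdge r _∙_ s a t =
    ∃[ p ] ∃[ q ] Σ (r ⟶ proj₁ q) λ h →
      proj₁ p ≡ s × proj₁ h ≡ a × proj₁ (p ∙ q) ≡ t

-- An edge-preserving map of a connected, deterministic and co-deterministic
-- graph is determined by the image of a single vertex, since every chain from
-- that vertex has a unique continuation.  Symmetry supplies for every s an
-- automorphism sending r to s; s ∙ t is the image of t under it, which is the end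
-- of the chain from s labelled like any chain from r to t.  Each group law is an
-- equality of edge-preserving maps that agree at one vertex, and an edge
-- s --a--> t means t = s ∙ q with r --a--> q, which yields both generation by
-- →(r) and the Cayley description.
module Submission where

open import Defs
open import Data.Product using (Σ; _×_; _,_; proj₁; proj₂)
open import Data.Sum using (inj₁; inj₂)
open import Function using (id; _∘_)
open import Relation.Binary.PropositionalEquality
open import Algebra.Bundles using (Group)
open import Algebra.Structures using (IsGroup)
import Algebra.Properties.Group as GroupProperties

module _ {V A : Set} (G : V → A → V → Set) where

  source : ∀ {s a t} → G s a t → VG G
  source {s} {a} {t} e = s , inj₁ (a , t , e)

  target : ∀ {s a t} → G s a t → VG G
  target {s} {a} {t} e = t , inj₂ (s , a , e)

  record IsEndomorphism (f : VG G → VG G) : Set where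
    field
      preserves : ∀ x y {a} → G (proj₁ x) a (proj₁ y) → G (proj₁ (f x)) a (proj₁ (f y))

  open IsEndomorphism public

  id-isEndomorphism : IsEndomorphism id
  id-isEndomorphism .preserves x y e = e

  ∘-isEndomorphism : ∀ {f g} → IsEndomorphism f → IsEndomorphism g →
                     IsEndomorphism (f ∘ g)
  ∘-isEndomorphism {g = g} hf hg .preserves x y e =
    preserves hf (g x) (g y) (preserves hg x y e)

  endomorphism-edge : ∀ {f x y t a} → IsEndomorphism f → proj₁ (f x) ≡ y →
                      G (proj₁ x) a (proj₁ t) → G y a (proj₁ (f t))
  endomorphism-edge {x = x} {t = t} hf refl = preserves hf x t

module Rigidity {V A : Set} (G : V → A → V → Set)
                (det : Deterministic G) (codet : CoDeterministic G) where

  infix 4 _≈_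
  _≈_ : VG G → VG G → Set
  _≈_ = _≈V_ G

  step-deterministic : ∀ {s} b {t t'} → Step G s b t → Step G s b t' → t ≡ t'
  step-deterministic (inj₁ a) = det
  step-deterministic (inj₂ a) = codet

  chain-deterministic : ∀ {s u y y'} → Chain G s u y → Chain G s u y' → y ≡ y'
  chain-deterministic chain-nil chain-nil = refl
  chain-deterministic (chain-cons {b = b} e c) (chain-cons e' c')
    with step-deterministic b e e'
  ... | refl = chain-deterministic c c'

  -- The vertex proofs of x and y may differ; an edge at the common vertex
  -- forces f x and f y to coincide.
  endomorphism-resp-≈ : ∀ {f} → IsEndomorphism G f → ∀ {x y} → x ≈ y → f x ≈ f y
  endomorphism-resp-≈ hf {x@(_ , inj₁ (a , t , e))} {y} refl =
    codet (preserves hf x (target G e) e) (preserves hf y (target G e) e)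
  endomorphism-resp-≈ hf {x@(_ , inj₂ (s , a , e))} {y} refl =
    det (preserves hf (source G e) x e) (preserves hf (source G e) y e)

  endomorphism-chain : ∀ {f} → IsEndomorphism G f → ∀ x y {u} →
    Chain G (proj₁ x) u (proj₁ y) → Chain G (proj₁ (f x)) u (proj₁ (f y))
  endomorphism-chain hf x y chain-nil =
    subst (Chain G _ _) (endomorphism-resp-≈ hf {x} {y} refl) chain-nil
  endomorphism-chain hf x y (chain-cons {b = inj₁ a} e c) =
    chain-cons (preserves hf x (target G e) e) (endomorphism-chain hf (target G e) y c)
  endomorphism-chain hf x y (chain-cons {b = inj₂ a} e c) =
    chain-cons (preserves hf (source G e) x e) (endomorphism-chain hf (source G e) y c)

  endomorphism-rigid : Connected G → ∀ {f g} → IsEndomorphism G f → IsEndomorphism G g →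
                       ∀ x → f x ≈ g x → ∀ y → f y ≈ g y
  endomorphism-rigid conn hf hg x fx≈gx y with conn x y
  ... | u , c =
    chain-deterministic (subst (λ w → Chain G w u _) fx≈gx (endomorphism-chain hf x y c))
                        (endomorphism-chain hg x y c)

module Translation {V A : Set} (G : V → A → V → Set)
  (conn : Connected G) (symm : Symmetric G)
  (det : Deterministic G) (codet : CoDeterministic G) (r : VG G) where

  open Rigidity G det codet

  move : VG G → VG G → VG G → VG G
  move s t = proj₁ (symm s t)

  move-isEndomorphism : ∀ s t → IsEndomorphism G (move s t)
  move-isEndomorphism s t .preserves x y {a} =
    let (_ , _ , _ , preserves-edges) = proj₁ (proj₂ (symm s t)) in
    proj₁ (preserves-edges x a y)

  move-maps : ∀ s t → move s t s ≈ t
  move-maps s t = proj₂ (proj₂ (symm s t))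

  rigid : ∀ {f g} → IsEndomorphism G f → IsEndomorphism G g →
          ∀ x → f x ≈ g x → ∀ y → f y ≈ g y
  rigid = endomorphism-rigid conn

  infixl 7 _∙_
  infix 8 _⁻¹

  _∙_ : VG G → VG G → VG G
  s ∙ t = move r s t

  _⁻¹ : VG G → VG G
  s ⁻¹ = move s r r

  ∙-isEndomorphism : ∀ s → IsEndomorphism G (s ∙_)
  ∙-isEndomorphism = move-isEndomorphism r

  ∙-unique : ∀ {f s} → IsEndomorphism G f → f r ≈ s → ∀ t → f t ≈ s ∙ t
  ∙-unique {s = s} hf fr≈s =
    rigid hf (∙-isEndomorphism s) r (trans fr≈s (sym (move-maps r s)))

  ∙-congˡ : ∀ s {t t'} → t ≈ t' → s ∙ t ≈ s ∙ t'
  ∙-congˡ s = endomorphism-resp-≈ (∙-isEndomorphism s)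

  ∙-move-back : ∀ s t → s ∙ move s r t ≈ t
  ∙-move-back s = rigid (∘-isEndomorphism G (∙-isEndomorphism s) (move-isEndomorphism s r))
    (id-isEndomorphism G) s (trans (∙-congˡ s (move-maps s r)) (move-maps r s))

  isGroup : IsGroup _≈_ _∙_ r _⁻¹
  isGroup = record
    { isMonoid = record
      { isSemigroup = record
        { isMagma = record
          { isEquivalence = record { refl = refl ; sym = sym ; trans = trans }
          ; ∙-cong = ∙-cong }
        ; assoc = assoc }
      ; identity = identityˡ , move-maps r }
    ; inverse = inverseˡ , inverseʳ
    ; ⁻¹-cong = ⁻¹-cong }
    where
    ∙-cong : ∀ {s s' t t'} → s ≈ s' → t ≈ t' → s ∙ t ≈ s' ∙ t'
    ∙-cong {s} {s'} {t} s≈s' t≈t' =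
      trans (∙-unique (∙-isEndomorphism s) (trans (move-maps r s) s≈s') t) (∙-congˡ s' t≈t')

    assoc : ∀ s t w → (s ∙ t) ∙ w ≈ s ∙ (t ∙ w)
    assoc s t w = sym (∙-unique (∘-isEndomorphism G (∙-isEndomorphism s) (∙-isEndomorphism t))
                                (∙-congˡ s (move-maps r t)) w)

    identityˡ : ∀ t → r ∙ t ≈ t
    identityˡ t = sym (∙-unique (id-isEndomorphism G) refl t)

    inverseˡ : ∀ s → s ⁻¹ ∙ s ≈ r
    inverseˡ s = trans (sym (∙-unique (move-isEndomorphism s r) refl s)) (move-maps s r)

    inverseʳ : ∀ s → s ∙ s ⁻¹ ≈ r
    inverseʳ s = ∙-move-back s r

    ⁻¹-cong : ∀ {s s'} → s ≈ s' → s ⁻¹ ≈ s' ⁻¹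
    ⁻¹-cong {s} {s'} s≈s' =
      rigid (move-isEndomorphism s r) (move-isEndomorphism s' r) s
        (trans (move-maps s r) (sym (trans (endomorphism-resp-≈ (move-isEndomorphism s' r) s≈s')
                                           (move-maps s' r))))
        r

  group : Group _ _
  group = record { isGroup = isGroup }

  open GroupProperties group using (x≈z//y)

  translate-chain : ∀ s t {u} → Chain G (proj₁ r) u (proj₁ t) → Chain G (proj₁ s) u (proj₁ (s ∙ t))
  translate-chain s t {u} c =
    subst (λ w → Chain G w u (proj₁ (s ∙ t))) (move-maps r s) (endomorphism-chain (∙-isEndomorphism s) r t c)

  chainRel-∙ : ∀ s t → ChainRel G (proj₁ r) (proj₁ s) (proj₁ t) (proj₁ (s ∙ t))
  chainRel-∙ s t with conn r t
  ... | u , c = u , c , translate-chain s t c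

  chainRel-unique : ∀ s t y → ChainRel G (proj₁ r) (proj₁ s) (proj₁ t) y → y ≡ proj₁ (s ∙ t)
  chainRel-unique s t y (u , c , c') = chain-deterministic c' (translate-chain s t c)

  edge⇒∙ : ∀ s t {a} → G (proj₁ s) a (proj₁ t) →
           Σ (VG G) λ q → G (proj₁ r) a (proj₁ q) × s ∙ q ≈ t
  edge⇒∙ s t e =
    move s r t , endomorphism-edge G (move-isEndomorphism s r) (move-maps s r) e , ∙-move-back s t

  ∙⇒edge : ∀ s q {a} → G (proj₁ r) a (proj₁ q) → G (proj₁ s) a (proj₁ (s ∙ q))
  ∙⇒edge s q = endomorphism-edge G (∙-isEndomorphism s) (move-maps r s)

  Generated : VG G → Set
  Generated = Gen _≈_ _∙_ r _⁻¹ (λ s → _⟶_ G (proj₁ r) (proj₁ s))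

  generated-along-chain : ∀ z y {u} → Generated z → Chain G (proj₁ z) u (proj₁ y) → Generated y
  generated-along-chain z y gz chain-nil = gen-resp refl gz
  generated-along-chain z y gz (chain-cons {b = inj₁ a} e c) with edge⇒∙ z (target G e) e
  ... | q , rq , zq≈t =
    generated-along-chain (target G e) y (gen-resp zq≈t (gen-mul gz (gen-base (a , rq)))) c
  generated-along-chain z y gz (chain-cons {b = inj₂ a} e c) with edge⇒∙ (source G e) z e
  ... | q , rq , tq≈z =
    generated-along-chain (source G e) y
      (gen-resp (sym (x≈z//y (source G e) q z tq≈z)) (gen-mul gz (gen-inv (gen-base (a , rq))))) c

  generatedBy : GeneratedBy _≈_ _∙_ r _⁻¹ (λ s → _⟶_ G (proj₁ r) (proj₁ s))
  generatedBy x with conn r x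
  ... | u , c = generated-along-chain r x gen-unit c

  cayley : ∀ s a t → (G s a t → CayleyEdge G (proj₁ r) _∙_ s a t) ×
                     (CayleyEdge G (proj₁ r) _∙_ s a t → G s a t)
  cayley s a t = to , from
    where
    to : G s a t → CayleyEdge G (proj₁ r) _∙_ s a t
    to e with edge⇒∙ (source G e) (target G e) e
    ... | q , rq , sq≈t = source G e , q , (a , rq) , refl , refl , sq≈t

    from : CayleyEdge G (proj₁ r) _∙_ s a t → G s a t
    from (p , q , (b , rq) , refl , refl , refl) = ∙⇒edge p q rq

proposition4p6 : {V A : Set} (G : V → A → V → Set) →
    NonEmpty G → Connected G → Symmetric G →
    Deterministic G → CoDeterministic G →
    (r : VG G) →
    Σ (VG G → VG G → VG G) λ _∙_ →
      (∀ (s t : VG G) →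
        ChainRel G (proj₁ r) (proj₁ s) (proj₁ t) (proj₁ (s ∙ t)) ×
        (∀ (y : V) → ChainRel G (proj₁ r) (proj₁ s) (proj₁ t) y → y ≡ proj₁ (s ∙ t))) ×
      (Σ (VG G → VG G) λ _⁻¹ →
        IsGroup (_≈V_ G) _∙_ r _⁻¹ ×
        GeneratedBy (_≈V_ G) _∙_ r _⁻¹ (λ s → _⟶_ G (proj₁ r) (proj₁ s))) ×
      (Simple G →
        ∀ (s : V) (a : A) (t : V) →
          (G s a t → CayleyEdge G (proj₁ r) _∙_ s a t) ×
          (CayleyEdge G (proj₁ r) _∙_ s a t → G s a t))
proposition4p6 G _ conn symm det codet r =
  _∙_ ,
  (λ s t → chainRel-∙ s t , chainRel-unique s t) ,
  (_⁻¹ , isGroup , generatedBy) ,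
  (λ _ → cayley)
  where open Translation G conn symm det codet r
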